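{- For every $L_\triangleright$ formula $\varphi$: $T_\triangleright+I\mathrm{Open}(L_\triangleright)\vdash\varphi$ if and only if $T^I_\triangleright\vdash\varphi$.
   Context: $L_\triangleright$ is the one-sorted first-order language with function symbols $0$ (constant), $s$, $p$ (unary), $+$ (binary, infix) and a binary predicate symbol $\triangleright$ (infix). $T_\triangleright$ is the theory with axioms (A1) $\forall x\, sx\neq 0$; (A2) $p0=0$; (A3) $\forall x\, p\,sx=x$; (A4) $\forall x\, x+0=x$; (A5) $\forall x\forall y\, x+sy=s(x+y)$; (A6) $0\triangleright 0$; (A7) $\forall x\forall y\,(x\triangleright y\to sx\triangleright (sx+y))$; (A8) $\forall x\forall y\,(sx\triangleright(sx+y)\to x\triangleright y)$; (A9) $\forall x\forall y\forall z\,(x\triangleright y\wedge x\triangleright z\to y=z)$. $T^I_\triangleright$ is $T_\triangleright$ together with (B1) $\forall x\,(x\neq0\to x=s\,p\,x)$; (B2) $\forall x\forall y\, x+y=y+x$; (B3) $\forall x\forall y\forall z\,(x+y)+z=x+(y+z)$; (B4) $\forall x\forall y\forall z\,(x+y=x+z\to y=z)$. For a formula $\psi(x,\vec z)$, $I_x\psi:=\forall\vec z\,(\psi(0,\vec z)\to\forall x(\psi(x,\vec z)\to\psi(sx,\vec z))\to\forall x\,\psi(x,\vec z))$, and $I\mathrm{Open}(L_\triangleright)$ is the set of all $I_x\psi$ with $\psi$ a quantifier-free $L_\triangleright$ formula. -}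

module Defs where

open import Data.Nat using (ℕ; zero; suc)
open import Data.Sum using (_⊎_)
open import Data.Product using (_×_)

infixl 8 _+'_
data Term : Set where
  var   : ℕ → Term
  0'    : Term
  s'    : Term → Term
  p'    : Term → Term
  _+'_  : Term → Term → Term

infix 6 _≐_ _▷_
infixr 4 _⇒_
infixr 5 _∨'_
infixr 5 _∧'_
data Formula : Set where
  ⊥'   : Formula
  _≐_  : Term → Term → Formula
  _▷_  : Term → Term → Formula
  _⇒_  : Formula → Formula → Formula
  _∧'_ : Formula → Formula → Formula
  _∨'_ : Formula → Formula → Formula
  ∀'   : Formula → Formula     -- binds variable 0
  ∃'   : Formula → Formula     -- binds variable 0

¬' : Formula → Formula
¬' A = A ⇒ ⊥'

Subst : Set
Subst = ℕ → Term

renT : (ℕ → ℕ) → Term → Term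
renT r (var x)  = var (r x)
renT r 0'       = 0'
renT r (s' t)   = s' (renT r t)
renT r (p' t)   = p' (renT r t)
renT r (t +' u) = renT r t +' renT r u

subT : Subst → Term → Term
subT σ (var x)  = σ x
subT σ 0'       = 0'
subT σ (s' t)   = s' (subT σ t)
subT σ (p' t)   = p' (subT σ t)
subT σ (t +' u) = subT σ t +' subT σ u

lift : Subst → Subst
lift σ zero    = var zero
lift σ (suc x) = renT suc (σ x)

sub : Subst → Formula → Formula
sub σ ⊥'        = ⊥'
sub σ (t ≐ u)   = subT σ t ≐ subT σ u
sub σ (t ▷ u)   = subT σ t ▷ subT σ u
sub σ (A ⇒ B)   = sub σ A ⇒ sub σ B
sub σ (A ∧' B)  = sub σ A ∧' sub σ B
sub σ (A ∨' B)  = sub σ A ∨' sub σ B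
sub σ (∀' A)    = ∀' (sub (lift σ) A)
sub σ (∃' A)    = ∃' (sub (lift σ) A)

shift : Formula → Formula
shift = sub (λ x → var (suc x))

single : Term → Subst
single t zero    = t
single t (suc x) = var x

_[_] : Formula → Term → Formula
A [ t ] = sub (single t) A

-- A theory is a set of formulas (free variables of axioms are read as
-- universally quantified, as usual with the generalization rule).

Theory : Set₁
Theory = Formula → Set

infix 2 _⊢_
data _⊢_ (Γ : Theory) : Formula → Set where
  ax    : ∀ {A} → Γ A → Γ ⊢ A
  K     : ∀ {A B} → Γ ⊢ A ⇒ B ⇒ A
  S     : ∀ {A B C} → Γ ⊢ (A ⇒ B ⇒ C) ⇒ (A ⇒ B) ⇒ A ⇒ C
  dne   : ∀ {A} → Γ ⊢ ¬' (¬' A) ⇒ A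
  ∧i    : ∀ {A B} → Γ ⊢ A ⇒ B ⇒ A ∧' B
  ∧e₁   : ∀ {A B} → Γ ⊢ A ∧' B ⇒ A
  ∧e₂   : ∀ {A B} → Γ ⊢ A ∧' B ⇒ B
  ∨i₁   : ∀ {A B} → Γ ⊢ A ⇒ A ∨' B
  ∨i₂   : ∀ {A B} → Γ ⊢ B ⇒ A ∨' B
  ∨e    : ∀ {A B C} → Γ ⊢ (A ⇒ C) ⇒ (B ⇒ C) ⇒ A ∨' B ⇒ C
  ∀e    : ∀ {A} t → Γ ⊢ ∀' A ⇒ A [ t ]
  ∀dist : ∀ {A B} → Γ ⊢ ∀' (shift A ⇒ B) ⇒ A ⇒ ∀' B
  ∃i    : ∀ {A} t → Γ ⊢ A [ t ] ⇒ ∃' A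
  ∃e    : ∀ {A B} → Γ ⊢ ∀' (A ⇒ shift B) ⇒ ∃' A ⇒ B
  refl≐ : ∀ t → Γ ⊢ t ≐ t
  subst≐ : ∀ {A} t u → Γ ⊢ t ≐ u ⇒ A [ t ] ⇒ A [ u ]
  mp    : ∀ {A B} → Γ ⊢ A ⇒ B → Γ ⊢ A → Γ ⊢ B
  gen   : ∀ {A} → Γ ⊢ A → Γ ⊢ ∀' A

_∪_ : Theory → Theory → Theory
(Γ ∪ Δ) A = Γ A ⊎ Δ A

-- variable names for readability: under ∀'∀'∀' (x y z),
-- x = var 2, y = var 1, z = var 0
data T▷ : Theory where
  A1 : T▷ (∀' (¬' (s' (var 0) ≐ 0')))
  A2 : T▷ (p' 0' ≐ 0')
  A3 : T▷ (∀' (p' (s' (var 0)) ≐ var 0))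
  A4 : T▷ (∀' (var 0 +' 0' ≐ var 0))
  A5 : T▷ (∀' (∀' (var 1 +' s' (var 0) ≐ s' (var 1 +' var 0))))
  A6 : T▷ (0' ▷ 0')
  A7 : T▷ (∀' (∀' (var 1 ▷ var 0 ⇒ s' (var 1) ▷ (s' (var 1) +' var 0))))
  A8 : T▷ (∀' (∀' (s' (var 1) ▷ (s' (var 1) +' var 0) ⇒ var 1 ▷ var 0)))
  A9 : T▷ (∀' (∀' (∀' (var 2 ▷ var 1 ∧' var 2 ▷ var 0 ⇒ var 1 ≐ var 0))))

data B-axioms : Theory where
  B1 : B-axioms (∀' (¬' (var 0 ≐ 0') ⇒ var 0 ≐ s' (p' (var 0))))
  B2 : B-axioms (∀' (∀' (var 1 +' var 0 ≐ var 0 +' var 1)))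
  B3 : B-axioms (∀' (∀' (∀' ((var 2 +' var 1) +' var 0 ≐ var 2 +' (var 1 +' var 0)))))
  B4 : B-axioms (∀' (∀' (∀' (var 2 +' var 1 ≐ var 2 +' var 0 ⇒ var 1 ≐ var 0))))

T▷I : Theory
T▷I = T▷ ∪ B-axioms

data QF : Formula → Set where
  ⊥'   : QF ⊥'
  _≐_  : ∀ t u → QF (t ≐ u)
  _▷_  : ∀ t u → QF (t ▷ u)
  _⇒_  : ∀ {A B} → QF A → QF B → QF (A ⇒ B)
  _∧'_ : ∀ {A B} → QF A → QF B → QF (A ∧' B)
  _∨'_ : ∀ {A B} → QF A → QF B → QF (A ∨' B)

succ-sub : Subst
succ-sub zero    = s' (var zero)
succ-sub (suc x) = var (suc x)

-- I_x ψ, with x = variable 0; the parameters z⃗ are the remaining free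
-- variables (implicitly universally quantified, equivalently closed by ∀z⃗).
Ind : Formula → Formula
Ind ψ = ψ [ 0' ] ⇒ ∀' (ψ ⇒ sub succ-sub ψ) ⇒ ∀' ψ

data IOpen : Theory where
  ind : ∀ {ψ} → QF ψ → IOpen (Ind ψ)

-- B1–B4 are instances of open induction, which gives one direction.  For the other, fix a
-- quantifier-free ψ(x).  In T▷I an element is either a numeral s^k 0, where ψ holds by iterating
-- the induction step, or it is s^R w for any prescribed R (B1 peels off successors).  Substituting
-- x := s^L u with L beyond the number of p's in ψ turns every term into a linear form s^n (k·u + d)
-- with d free of u.  Each atom then either does not depend on u, or holds at most once along any
-- chain u, s u, s² u, ...: for equations with different coefficients by B4, for ▷ because A9
-- conflicts with the growth forced by A7.  Among W + 1 points of a chain, W the number of such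
-- varying atoms, one avoids them all by pigeonhole, and there ψ(s^L u) is equivalent to the
-- u-free formula obtained by falsifying them.  On the numerals this shows that formula true; on
-- the chain through w it yields ψ(s^(L+j) w) for some j ≤ W, hence ψ(s^(L+W) w) by iteration.

module Submission where

open import Defs
open import Data.Empty using (⊥-elim)
open import Data.Fin using (Fin; zero; suc; toℕ; punchIn)
open import Data.Fin.Properties
  using (suc-injective; toℕ-injective; toℕ≤pred[n]; punchIn-injective; punchInᵢ≢i)
open import Data.List using (List; []; _∷_; _++_; length)
open import Data.List.Relation.Unary.All as All using (All; []; _∷_)
open import Data.List.Relation.Unary.All.Properties using (++⁺)
open import Data.Nat using (ℕ; zero; suc; _+_; _*_; _≤_; _<_; z≤n; s≤s; _≟_)
import Data.Nat.Properties as ℕ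
open import Data.Product using (_×_; _,_; proj₁; proj₂; ∃)
open import Data.Sum using (inj₁; inj₂)
open import Data.Unit using (⊤)
open import Function using (_∘_)
open import Relation.Binary.Bundles using (Setoid)
import Relation.Binary.Reasoning.Setoid as SetoidReasoning
open import Relation.Binary.Definitions using (tri<; tri≈; tri>)
open import Relation.Binary.PropositionalEquality hiding ([_])
open import Relation.Nullary using (yes; no)
open import Relation.Unary using (_⊆_)

subT-renT : ∀ σ r t → subT σ (renT r t) ≡ subT (σ ∘ r) t
subT-renT σ r (var x)  = refl
subT-renT σ r 0'       = refl
subT-renT σ r (s' t)   = cong s' (subT-renT σ r t)
subT-renT σ r (p' t)   = cong p' (subT-renT σ r t)
subT-renT σ r (t +' u) = cong₂ _+'_ (subT-renT σ r t) (subT-renT σ r u)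

subT-subT : ∀ {σ τ ρ} → (∀ x → subT σ (τ x) ≡ ρ x) → ∀ t → subT σ (subT τ t) ≡ subT ρ t
subT-subT h (var x)  = h x
subT-subT h 0'       = refl
subT-subT h (s' t)   = cong s' (subT-subT h t)
subT-subT h (p' t)   = cong p' (subT-subT h t)
subT-subT h (t +' u) = cong₂ _+'_ (subT-subT h t) (subT-subT h u)

subT-id : ∀ {σ} → (∀ x → σ x ≡ var x) → ∀ t → subT σ t ≡ t
subT-id h (var x)  = h x
subT-id h 0'       = refl
subT-id h (s' t)   = cong s' (subT-id h t)
subT-id h (p' t)   = cong p' (subT-id h t)
subT-id h (t +' u) = cong₂ _+'_ (subT-id h t) (subT-id h u)

subT-single-wk : ∀ v t → subT (single v) (renT suc t) ≡ t
subT-single-wk v t = trans (subT-renT (single v) suc t) (subT-id (λ _ → refl) t)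

subT-single-lift-wk² : ∀ v w t → subT (single w) (subT (lift (single v)) (renT suc (renT suc t))) ≡ t
subT-single-lift-wk² v w t = begin
  subT (single w) (subT (lift (single v)) (renT suc (renT suc t)))
    ≡⟨ cong (subT (single w)) (trans (subT-renT (lift (single v)) suc (renT suc t)) (subT-renT _ suc t)) ⟩
  subT (single w) (subT (λ x → var (suc x)) t)  ≡⟨ subT-subT {ρ = var} (λ _ → refl) t ⟩
  subT var t                                    ≡⟨ subT-id (λ _ → refl) t ⟩
  t                                             ∎
  where open ≡-Reasoning

sub-QF : ∀ {ψ} σ → QF ψ → QF (sub σ ψ)
sub-QF σ ⊥'       = ⊥'
sub-QF σ (t ≐ u)  = _ ≐ _
sub-QF σ (t ▷ u)  = _ ▷ _
sub-QF σ (a ⇒ b)  = sub-QF σ a ⇒ sub-QF σ b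
sub-QF σ (a ∧' b) = sub-QF σ a ∧' sub-QF σ b
sub-QF σ (a ∨' b) = sub-QF σ a ∨' sub-QF σ b

sub-sub : ∀ {ψ σ τ ρ} → QF ψ → (∀ x → subT σ (τ x) ≡ ρ x) → sub σ (sub τ ψ) ≡ sub ρ ψ
sub-sub ⊥'       h = refl
sub-sub (t ≐ u)  h = cong₂ _≐_ (subT-subT h t) (subT-subT h u)
sub-sub (t ▷ u)  h = cong₂ _▷_ (subT-subT h t) (subT-subT h u)
sub-sub (a ⇒ b)  h = cong₂ _⇒_ (sub-sub a h) (sub-sub b h)
sub-sub (a ∧' b) h = cong₂ _∧'_ (sub-sub a h) (sub-sub b h)
sub-sub (a ∨' b) h = cong₂ _∨'_ (sub-sub a h) (sub-sub b h)

sub-id : ∀ {ψ σ} → QF ψ → (∀ x → σ x ≡ var x) → sub σ ψ ≡ ψ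
sub-id ⊥'       h = refl
sub-id (t ≐ u)  h = cong₂ _≐_ (subT-id h t) (subT-id h u)
sub-id (t ▷ u)  h = cong₂ _▷_ (subT-id h t) (subT-id h u)
sub-id (a ⇒ b)  h = cong₂ _⇒_ (sub-id a h) (sub-id b h)
sub-id (a ∧' b) h = cong₂ _∧'_ (sub-id a h) (sub-id b h)
sub-id (a ∨' b) h = cong₂ _∨'_ (sub-id a h) (sub-id b h)

-- Natural deduction on top of the Hilbert calculus

⊢-cut : ∀ {Γ Δ : Theory} → (∀ {A} → Γ A → Δ ⊢ A) → ∀ {φ} → Γ ⊢ φ → Δ ⊢ φ
⊢-cut f (ax x)       = f x
⊢-cut f K            = K
⊢-cut f S            = S
⊢-cut f dne          = dne
⊢-cut f ∧i           = ∧i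
⊢-cut f ∧e₁          = ∧e₁
⊢-cut f ∧e₂          = ∧e₂
⊢-cut f ∨i₁          = ∨i₁
⊢-cut f ∨i₂          = ∨i₂
⊢-cut f ∨e           = ∨e
⊢-cut f (∀e t)       = ∀e t
⊢-cut f ∀dist        = ∀dist
⊢-cut f (∃i t)       = ∃i t
⊢-cut f ∃e           = ∃e
⊢-cut f (refl≐ t)    = refl≐ t
⊢-cut f (subst≐ t u) = subst≐ t u
⊢-cut f (mp d e)     = mp (⊢-cut f d) (⊢-cut f e)
⊢-cut f (gen d)      = gen (⊢-cut f d)

module Deduction (Th : Theory) where

  infixl 4 _,,_
  data Ctx : Set where
    ε    : Ctx
    _,,_ : Ctx → Formula → Ctx

  _⇛_ : Ctx → Formula → Formula
  ε        ⇛ A = A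
  (Γ ,, H) ⇛ A = Γ ⇛ (H ⇒ A)

  -- Derivations under hypotheses Γ are derivations of the curried implication Γ ⇛ A,
  -- so the deduction theorem (lam) holds by definition.
  infix 2 _⊩_
  record _⊩_ (Γ : Ctx) (A : Formula) : Set where
    constructor ⟨_⟩
    field unwrap : Th ⊢ Γ ⇛ A
  open _⊩_ public

  embed : ∀ {Γ A} → Th ⊢ A → Γ ⊩ A
  embed {ε}      d = ⟨ d ⟩
  embed {Γ ,, H} d = ⟨ unwrap (embed {Γ} (mp K d)) ⟩

  app : ∀ {Γ A B} → Γ ⊩ A ⇒ B → Γ ⊩ A → Γ ⊩ B
  app {ε}      ⟨ f ⟩ ⟨ a ⟩ = ⟨ mp f a ⟩
  app {Γ ,, H} ⟨ f ⟩ ⟨ a ⟩ = ⟨ unwrap (app {Γ} (app {Γ} (embed S) ⟨ f ⟩) ⟨ a ⟩) ⟩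

  lam : ∀ {Γ H A} → Γ ,, H ⊩ A → Γ ⊩ H ⇒ A
  lam ⟨ d ⟩ = ⟨ d ⟩

  hyp : ∀ {Γ A} → Γ ,, A ⊩ A
  hyp {Γ} {A} = ⟨ unwrap (embed {Γ} (mp (mp S K) (K {B = A}))) ⟩

  wk : ∀ {Γ A H} → Γ ⊩ A → Γ ,, H ⊩ A
  wk {Γ} d = ⟨ unwrap (app (embed {Γ} K) d) ⟩

  ⊤-intro : ∀ {Γ} → Γ ⊩ ¬' ⊥'
  ⊤-intro = lam hyp

  ∧-intro : ∀ {Γ A B} → Γ ⊩ A → Γ ⊩ B → Γ ⊩ A ∧' B
  ∧-intro a b = app (app (embed ∧i) a) b

  ∧-elimˡ : ∀ {Γ A B} → Γ ⊩ A ∧' B → Γ ⊩ A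
  ∧-elimˡ = app (embed ∧e₁)

  ∧-elimʳ : ∀ {Γ A B} → Γ ⊩ A ∧' B → Γ ⊩ B
  ∧-elimʳ = app (embed ∧e₂)

  ∨-elim : ∀ {Γ A B C} → Γ ⊩ A ∨' B → Γ ,, A ⊩ C → Γ ,, B ⊩ C → Γ ⊩ C
  ∨-elim d f g = app (app (app (embed ∨e) (lam f)) (lam g)) d

  explode : ∀ {Γ A} → Γ ⊩ ⊥' → Γ ⊩ A
  explode d = app (embed dne) (app (embed K) d)

  by-contradiction : ∀ {Γ A} → Γ ,, ¬' A ⊩ ⊥' → Γ ⊩ A
  by-contradiction d = app (embed dne) (lam d)

  by-cases : ∀ {Γ C} A → Γ ,, A ⊩ C → Γ ,, ¬' A ⊩ C → Γ ⊩ C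
  by-cases {Γ} {C} A f g = by-contradiction (app hyp (app (wk (lam g)) ¬A))
    where
    ¬A : Γ ,, ¬' C ⊩ ¬' A
    ¬A = lam (app (wk hyp) (app (wk (wk (lam f))) hyp))

  ∀-elim : ∀ {Γ A} → Γ ⊩ ∀' A → (t : Term) → Γ ⊩ A [ t ]
  ∀-elim d t = app (embed (∀e t)) d

  infix 2 _⊩_⇔_
  _⊩_⇔_ : Ctx → Formula → Formula → Set
  Γ ⊩ A ⇔ B = (Γ ⊩ A ⇒ B) × (Γ ⊩ B ⇒ A)

  ⇔-⇒ : ∀ {Γ A A' B B'} → Γ ⊩ A ⇔ A' → Γ ⊩ B ⇔ B' → Γ ⊩ (A ⇒ B) ⇔ (A' ⇒ B')
  ⇔-⇒ (f , f') (g , g') = mono f' g , mono f g'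
    where
    mono : ∀ {Γ A A' B B'} → Γ ⊩ A' ⇒ A → Γ ⊩ B ⇒ B' → Γ ⊩ (A ⇒ B) ⇒ (A' ⇒ B')
    mono f g = lam (lam (app (wk (wk g)) (app (wk hyp) (app (wk (wk f)) hyp))))

  ⇔-∧ : ∀ {Γ A A' B B'} → Γ ⊩ A ⇔ A' → Γ ⊩ B ⇔ B' → Γ ⊩ (A ∧' B) ⇔ (A' ∧' B')
  ⇔-∧ (f , f') (g , g') = mono f g , mono f' g'
    where
    mono : ∀ {Γ A A' B B'} → Γ ⊩ A ⇒ A' → Γ ⊩ B ⇒ B' → Γ ⊩ A ∧' B ⇒ A' ∧' B'
    mono f g = lam (∧-intro (app (wk f) (∧-elimˡ hyp)) (app (wk g) (∧-elimʳ hyp)))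

  ⇔-∨ : ∀ {Γ A A' B B'} → Γ ⊩ A ⇔ A' → Γ ⊩ B ⇔ B' → Γ ⊩ (A ∨' B) ⇔ (A' ∨' B')
  ⇔-∨ (f , f') (g , g') = mono f g , mono f' g'
    where
    mono : ∀ {Γ A A' B B'} → Γ ⊩ A ⇒ A' → Γ ⊩ B ⇒ B' → Γ ⊩ A ∨' B ⇒ A' ∨' B'
    mono f g = lam (∨-elim hyp (app (embed ∨i₁) (app (wk (wk f)) hyp))
                               (app (embed ∨i₂) (app (wk (wk g)) hyp)))

  ⇒-trans : ∀ {Γ A B C} → Γ ⊩ A ⇒ B → Γ ⊩ B ⇒ C → Γ ⊩ A ⇒ C
  ⇒-trans f g = lam (app (wk g) (app (wk f) hyp))

  ⇔-trans : ∀ {Γ A B C} → Γ ⊩ A ⇔ B → Γ ⊩ B ⇔ C → Γ ⊩ A ⇔ C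
  ⇔-trans (f , f') (g , g') = ⇒-trans f g , ⇒-trans g' f'

  ≐-refl : ∀ {Γ} t → Γ ⊩ t ≐ t
  ≐-refl t = embed (refl≐ t)

  ≐-subst : ∀ {Γ t u} A → Γ ⊩ t ≐ u → Γ ⊩ A [ t ] → Γ ⊩ A [ u ]
  ≐-subst {t = t} {u} A e d = app (app (embed (subst≐ {A = A} t u)) e) d

  ≐-transport : ∀ {Γ t u} A {F : Term → Formula} → (∀ x → A [ x ] ≡ F x) →
                Γ ⊩ t ≐ u → Γ ⊩ F t → Γ ⊩ F u
  ≐-transport {Γ} A h e d = subst (Γ ⊩_) (h _) (≐-subst A e (subst (Γ ⊩_) (sym (h _)) d))

  ≐-sym : ∀ {Γ t u} → Γ ⊩ t ≐ u → Γ ⊩ u ≐ t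
  ≐-sym {t = t} e =
    ≐-transport (var 0 ≐ renT suc t) (λ x → cong (x ≐_) (subT-single-wk x t)) e (≐-refl t)

  ≐-trans : ∀ {Γ t u v} → Γ ⊩ t ≐ u → Γ ⊩ u ≐ v → Γ ⊩ t ≐ v
  ≐-trans {t = t} e f = ≐-transport (renT suc t ≐ var 0) (λ x → cong (_≐ x) (subT-single-wk x t)) f e

  ≐-setoid : Ctx → Setoid _ _
  ≐-setoid Γ = record
    { Carrier       = Term
    ; _≈_           = λ t u → Γ ⊩ t ≐ u
    ; isEquivalence = record { refl = ≐-refl _ ; sym = ≐-sym ; trans = ≐-trans }
    }

  module ≐-Reasoning (Γ : Ctx) = SetoidReasoning (≐-setoid Γ)

  ≐-cong : ∀ {Γ t u} (C : Term → Term) c → (∀ x → subT (single x) c ≡ C x) →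
           Γ ⊩ t ≐ u → Γ ⊩ C t ≐ C u
  ≐-cong {t = t} C c h e =
    ≐-transport (renT suc (C t) ≐ c) (λ x → cong₂ _≐_ (subT-single-wk x (C t)) (h x))
                e (≐-refl (C t))

  s-cong : ∀ {Γ t u} → Γ ⊩ t ≐ u → Γ ⊩ s' t ≐ s' u
  s-cong = ≐-cong s' (s' (var 0)) (λ _ → refl)

  p-cong : ∀ {Γ t u} → Γ ⊩ t ≐ u → Γ ⊩ p' t ≐ p' u
  p-cong = ≐-cong p' (p' (var 0)) (λ _ → refl)

  +-congʳ : ∀ {Γ t u} v → Γ ⊩ t ≐ u → Γ ⊩ t +' v ≐ u +' v
  +-congʳ v = ≐-cong (_+' v) (var 0 +' renT suc v) (λ x → cong (x +'_) (subT-single-wk x v))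

  +-congˡ : ∀ {Γ t u} v → Γ ⊩ t ≐ u → Γ ⊩ v +' t ≐ v +' u
  +-congˡ v = ≐-cong (v +'_) (renT suc v +' var 0) (λ x → cong (_+' x) (subT-single-wk x v))

  +-cong : ∀ {Γ t u t' u'} → Γ ⊩ t ≐ u → Γ ⊩ t' ≐ u' → Γ ⊩ t +' t' ≐ u +' u'
  +-cong {u = u} {t'} e f = ≐-trans (+-congʳ t' e) (+-congˡ u f)

  ▷-respˡ-≐ : ∀ {Γ t u v} → Γ ⊩ t ≐ u → Γ ⊩ t ▷ v → Γ ⊩ u ▷ v
  ▷-respˡ-≐ {v = v} = ≐-transport (var 0 ▷ renT suc v) (λ x → cong (x ▷_) (subT-single-wk x v))

  ▷-respʳ-≐ : ∀ {Γ t u v} → Γ ⊩ t ≐ u → Γ ⊩ v ▷ t → Γ ⊩ v ▷ u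
  ▷-respʳ-≐ {v = v} = ≐-transport (renT suc v ▷ var 0) (λ x → cong (_▷ x) (subT-single-wk x v))

  ≐-⇔ : ∀ {Γ t t' u u'} → Γ ⊩ t ≐ t' → Γ ⊩ u ≐ u' → Γ ⊩ (t ≐ u) ⇔ (t' ≐ u')
  ≐-⇔ e f = lam (≐-trans (≐-sym (wk e)) (≐-trans hyp (wk f))) ,
            lam (≐-trans (wk e) (≐-trans hyp (≐-sym (wk f))))

  ▷-⇔ : ∀ {Γ t t' u u'} → Γ ⊩ t ≐ t' → Γ ⊩ u ≐ u' → Γ ⊩ (t ▷ u) ⇔ (t' ▷ u')
  ▷-⇔ e f = lam (▷-respˡ-≐ (wk e) (▷-respʳ-≐ (wk f) hyp)) ,
            lam (▷-respˡ-≐ (≐-sym (wk e)) (▷-respʳ-≐ (≐-sym (wk f)) hyp))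

  module _ {A X : Set} (P : A → X → Formula) where

    avoids : List A → X → Formula
    avoids []       x = ¬' ⊥'
    avoids (a ∷ as) x = ¬' (P a x) ∧' avoids as x

    avoids-++ : ∀ {Γ x} as bs → Γ ⊩ avoids (as ++ bs) x → (Γ ⊩ avoids as x) × (Γ ⊩ avoids bs x)
    avoids-++ []       bs h = ⊤-intro , h
    avoids-++ (a ∷ as) bs h with avoids-++ as bs (∧-elimʳ h)
    ... | h₁ , h₂ = ∧-intro (∧-elimˡ h) h₁ , h₂

    AtMostOnceOn : ∀ {N} → (Fin N → X) → A → Set
    AtMostOnceOn pt a = ∀ {Γ i j} → i ≢ j → Γ ⊩ P a (pt i) → Γ ⊩ P a (pt j) → Γ ⊩ ⊥'

    restrict : ∀ {M N} {pt : Fin N → X} {f : Fin M → Fin N} {as} →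
               (∀ {i j} → f i ≡ f j → i ≡ j) →
               All (AtMostOnceOn pt) as → All (AtMostOnceOn (pt ∘ f)) as
    restrict f-injective = All.map (λ once {_} {_} {_} i≢j → once (i≢j ∘ f-injective))

    -- Under ¬ C the first atom fails at every point (where it held, the other points would avoid
    -- it and the induction hypothesis would give C); dropping any one point, induction applies.
    pigeonhole : ∀ {Γ C N} as (pt : Fin N → X) → All (AtMostOnceOn pt) as → length as < N →
                 (∀ i → Γ ⊩ avoids as (pt i) ⇒ C) → Γ ⊩ C
    pigeonhole [] pt _ (s≤s _) h = app (h zero) ⊤-intro
    pigeonhole {Γ} {C} (a ∷ as) pt (once ∷ onces) (s≤s |as|<N) h =
      by-contradiction (app hyp (pigeonhole as (pt ∘ suc) (restrict suc-injective onces) |as|<N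
        (λ i → drop (¬a (suc i)) (wk (h (suc i))))))
      where
      drop : ∀ {Δ x} → Δ ⊩ ¬' (P a x) → Δ ⊩ avoids (a ∷ as) x ⇒ C → Δ ⊩ avoids as x ⇒ C
      drop ¬ax f = lam (app (wk f) (∧-intro (wk ¬ax) hyp))

      a⇒C : ∀ i → Γ ⊩ P a (pt i) ⇒ C
      a⇒C i = lam (pigeonhole as (pt ∘ punchIn i) (restrict (punchIn-injective i _ _) onces) |as|<N
        (λ j → drop (lam (once (punchInᵢ≢i i j ∘ sym) (wk hyp) hyp)) (wk (h (punchIn i j)))))

      ¬a : ∀ i → Γ ,, ¬' C ⊩ ¬' (P a (pt i))
      ¬a i = lam (app (wk hyp) (app (wk (wk (a⇒C i))) hyp))

  module T▷-rules (T▷⊆Th : T▷ ⊆ Th) where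

    axiom : ∀ {Γ A} → T▷ A → Γ ⊩ A
    axiom a = embed (ax (T▷⊆Th a))

    s≢0 : ∀ {Γ t} → Γ ⊩ s' t ≐ 0' → Γ ⊩ ⊥'
    s≢0 {t = t} = app (∀-elim (axiom A1) t)

    p-s : ∀ {Γ} t → Γ ⊩ p' (s' t) ≐ t
    p-s = ∀-elim (axiom A3)

    +-identityʳ : ∀ {Γ} t → Γ ⊩ t +' 0' ≐ t
    +-identityʳ = ∀-elim (axiom A4)

    +-suc : ∀ {Γ} t u → Γ ⊩ t +' s' u ≐ s' (t +' u)
    +-suc {Γ} t u = subst (λ x → Γ ⊩ x +' s' u ≐ s' (x +' u)) (subT-single-wk u t)
                          (∀-elim (∀-elim (axiom A5) t) u)

    ▷-step : ∀ {Γ t u} → Γ ⊩ t ▷ u → Γ ⊩ s' t ▷ (s' t +' u)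
    ▷-step {Γ} {t} {u} = app (subst (λ x → Γ ⊩ x ▷ u ⇒ s' x ▷ (s' x +' u)) (subT-single-wk u t)
                                   (∀-elim (∀-elim (axiom A7) t) u))

    ▷-functional : ∀ {Γ t u v} → Γ ⊩ t ▷ u → Γ ⊩ t ▷ v → Γ ⊩ u ≐ v
    ▷-functional {Γ} {t} {u} {v} d e =
      app (subst₂ (λ x y → Γ ⊩ x ▷ y ∧' x ▷ v ⇒ y ≐ v)
                  (subT-single-lift-wk² u v t) (subT-single-wk v u)
                  (∀-elim (∀-elim (∀-elim (axiom A9) t) u) v))
          (∧-intro d e)

-- Open induction proves B1–B4

module B-axioms-from-IOpen where

  open Deduction (T▷ ∪ IOpen)
  open T▷-rules inj₁

  induction : ∀ {ψ} → QF ψ → ε ⊩ ψ [ 0' ] → ε ,, ψ ⊩ sub succ-sub ψ → ε ⊩ ∀' ψ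
  induction q ⟨ base ⟩ ⟨ step ⟩ = ⟨ mp (mp (ax (inj₂ (ind q))) base) (gen step) ⟩

  generalize : ∀ {A} → ε ⊩ A → ε ⊩ ∀' A
  generalize ⟨ d ⟩ = ⟨ gen d ⟩

  x y z : Term
  x = var 2
  y = var 1
  z = var 0

  +-identityˡ : ∀ {Γ} t → Γ ⊩ 0' +' t ≐ t
  +-identityˡ t = ∀-elim (embed (unwrap +-identityˡ∀)) t
    where
    +-identityˡ∀ : ε ⊩ ∀' (0' +' z ≐ z)
    +-identityˡ∀ = induction (_ ≐ _) (+-identityʳ 0') (≐-trans (+-suc 0' z) (s-cong hyp))

  suc-+ : ∀ {Γ} t u → Γ ⊩ s' t +' u ≐ s' (t +' u)
  suc-+ {Γ} t u = subst (λ w → Γ ⊩ s' w +' u ≐ s' (w +' u)) (subT-single-wk u t)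
                       (∀-elim (∀-elim (embed (unwrap suc-+∀)) t) u)
    where
    suc-+∀ : ε ⊩ ∀' (∀' (s' y +' z ≐ s' (y +' z)))
    suc-+∀ = generalize (induction (_ ≐ _)
      (≐-trans (+-identityʳ (s' z)) (s-cong (≐-sym (+-identityʳ z))))
      (≐-trans (+-suc (s' y) z) (≐-trans (s-cong hyp) (s-cong (≐-sym (+-suc y z))))))

  B1-proof : ε ⊩ ∀' (¬' (z ≐ 0') ⇒ z ≐ s' (p' z))
  B1-proof = induction (((_ ≐ _) ⇒ ⊥') ⇒ (_ ≐ _))
    (lam (explode (app hyp (≐-refl 0'))))
    (lam (wk (≐-sym (s-cong (p-s z)))))

  B2-proof : ε ⊩ ∀' (∀' (y +' z ≐ z +' y))
  B2-proof = generalize (induction (_ ≐ _)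
    (≐-trans (+-identityʳ z) (≐-sym (+-identityˡ z)))
    (≐-trans (+-suc y z) (≐-trans (s-cong hyp) (≐-sym (suc-+ z y)))))

  B3-proof : ε ⊩ ∀' (∀' (∀' ((x +' y) +' z ≐ x +' (y +' z))))
  B3-proof = generalize (generalize (induction (_ ≐ _)
    (≐-trans (+-identityʳ (y +' z)) (≐-sym (+-congˡ y (+-identityʳ z))))
    (≐-trans (+-suc (x +' y) z) (≐-trans (s-cong hyp)
      (≐-trans (≐-sym (+-suc x (y +' z))) (+-congˡ x (≐-sym (+-suc y z))))))))

  -- Induction on the cancelled summand, which has to be moved to variable 0.
  B4-proof : ε ⊩ ∀' (∀' (∀' (x +' y ≐ x +' z ⇒ y ≐ z)))
  B4-proof = generalize (generalize (generalize (∀-elim cancel x)))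
    where
    cancel : ε ⊩ ∀' (z +' x ≐ z +' y ⇒ x ≐ y)
    cancel = induction ((_ ≐ _) ⇒ (_ ≐ _))
      (lam (≐-trans (≐-sym (+-identityˡ y)) (≐-trans hyp (+-identityˡ z))))
      (lam (app (wk hyp) (≐-trans (≐-sym (p-s (z +' x))) (≐-trans (p-cong (≐-sym (suc-+ z x)))
        (≐-trans (p-cong hyp) (≐-trans (p-cong (suc-+ z y)) (p-s (z +' y))))))))

  B-axiom-provable : ∀ {A} → B-axioms A → T▷ ∪ IOpen ⊢ A
  B-axiom-provable B1 = unwrap B1-proof
  B-axiom-provable B2 = unwrap B2-proof
  B-axiom-provable B3 = unwrap B3-proof
  B-axiom-provable B4 = unwrap B4-proof

open Deduction T▷I
open T▷-rules inj₁

B-axiom : ∀ {Γ A} → B-axioms A → Γ ⊩ A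
B-axiom b = embed (ax (inj₂ b))

≢0⇒≐s-p : ∀ {Γ t} → Γ ⊩ ¬' (t ≐ 0') → Γ ⊩ t ≐ s' (p' t)
≢0⇒≐s-p {t = t} = app (∀-elim (B-axiom B1) t)

+-comm : ∀ {Γ} t u → Γ ⊩ t +' u ≐ u +' t
+-comm {Γ} t u = subst (λ x → Γ ⊩ x +' u ≐ u +' x) (subT-single-wk u t)
                       (∀-elim (∀-elim (B-axiom B2) t) u)

+-assoc : ∀ {Γ} t u v → Γ ⊩ (t +' u) +' v ≐ t +' (u +' v)
+-assoc {Γ} t u v = subst₂ (λ x y → Γ ⊩ (x +' y) +' v ≐ x +' (y +' v))
                           (subT-single-lift-wk² u v t) (subT-single-wk v u)
                           (∀-elim (∀-elim (∀-elim (B-axiom B3) t) u) v)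

+-cancelˡ : ∀ {Γ t u v} → Γ ⊩ t +' u ≐ t +' v → Γ ⊩ u ≐ v
+-cancelˡ {Γ} {t} {u} {v} = app (subst₂ (λ x y → Γ ⊩ x +' y ≐ x +' v ⇒ y ≐ v)
                                         (subT-single-lift-wk² u v t) (subT-single-wk v u)
                                         (∀-elim (∀-elim (∀-elim (B-axiom B4) t) u) v))

+-identityˡ : ∀ {Γ} t → Γ ⊩ 0' +' t ≐ t
+-identityˡ t = ≐-trans (+-comm 0' t) (+-identityʳ t)

suc-+ : ∀ {Γ} t u → Γ ⊩ s' t +' u ≐ s' (t +' u)
suc-+ t u = ≐-trans (+-comm (s' t) u) (≐-trans (+-suc u t) (s-cong (+-comm u t)))

s^ : ℕ → Term → Term
s^ zero    t = t
s^ (suc n) t = s' (s^ n t)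

s^-+ : ∀ m n t → s^ m (s^ n t) ≡ s^ (m + n) t
s^-+ zero    n t = refl
s^-+ (suc m) n t = cong s' (s^-+ m n t)

s^-suc : ∀ n t → s^ n (s' t) ≡ s^ (suc n) t
s^-suc zero    t = refl
s^-suc (suc n) t = cong s' (s^-suc n t)

s^-comm : ∀ m n t → s^ m (s^ n t) ≡ s^ n (s^ m t)
s^-comm m n t = trans (s^-+ m n t) (trans (cong (λ k → s^ k t) (ℕ.+-comm m n)) (sym (s^-+ n m t)))

s^-< : ∀ {m n} t → m < n → ∃ λ o → s^ n t ≡ s^ m (s^ (suc o) t)
s^-< {m} t m<n with ℕ.m≤n⇒∃[o]m+o≡n m<n
... | o , refl = o , trans (cong (λ k → s^ k t) (sym (ℕ.+-suc m o))) (sym (s^-+ m (suc o) t))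

s^-cong : ∀ {Γ t u} n → Γ ⊩ t ≐ u → Γ ⊩ s^ n t ≐ s^ n u
s^-cong zero    e = e
s^-cong (suc n) e = s-cong (s^-cong n e)

s^-+ˡ : ∀ {Γ} m t u → Γ ⊩ s^ m t +' u ≐ s^ m (t +' u)
s^-+ˡ zero    t u = ≐-refl _
s^-+ˡ (suc m) t u = ≐-trans (suc-+ (s^ m t) u) (s-cong (s^-+ˡ m t u))

s^-+ʳ : ∀ {Γ} n t u → Γ ⊩ t +' s^ n u ≐ s^ n (t +' u)
s^-+ʳ zero    t u = ≐-refl _
s^-+ʳ (suc n) t u = ≐-trans (+-suc t (s^ n u)) (s-cong (s^-+ʳ n t u))

s^-+-s^ : ∀ {Γ} m n t u → Γ ⊩ s^ m t +' s^ n u ≐ s^ (m + n) (t +' u)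
s^-+-s^ {Γ} m n t u = begin
  s^ m t +' s^ n u      ≈⟨ s^-+ˡ m t (s^ n u) ⟩
  s^ m (t +' s^ n u)    ≈⟨ s^-cong m (s^-+ʳ n t u) ⟩
  s^ m (s^ n (t +' u))  ≡⟨ s^-+ m n (t +' u) ⟩
  s^ (m + n) (t +' u)   ∎
  where open ≐-Reasoning Γ

s^-cancel : ∀ {Γ t u} n → Γ ⊩ s^ n t ≐ s^ n u → Γ ⊩ t ≐ u
s^-cancel zero    e = e
s^-cancel (suc n) e = s^-cancel n (≐-trans (≐-sym (p-s _)) (≐-trans (p-cong e) (p-s _)))

s^-+-acyclic : ∀ {Γ} n v t → Γ ⊩ s^ (suc n) (v +' t) ≐ t → Γ ⊩ ⊥'
s^-+-acyclic {Γ} n v t e = s≢0 (+-cancelˡ (begin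
  t +' s^ (suc n) v     ≈⟨ s^-+ʳ (suc n) t v ⟩
  s^ (suc n) (t +' v)   ≈⟨ s^-cong (suc n) (+-comm t v) ⟩
  s^ (suc n) (v +' t)   ≈⟨ e ⟩
  t                     ≈⟨ +-identityʳ t ⟨
  t +' 0'               ∎))
  where open ≐-Reasoning Γ

s^-acyclic : ∀ {Γ t} n → Γ ⊩ s^ (suc n) t ≐ t → Γ ⊩ ⊥'
s^-acyclic {t = t} n e = s^-+-acyclic n 0' t (≐-trans (s^-cong (suc n) (+-identityˡ t)) e)

s^-<-cancel : ∀ {Γ m n t u} → m < n → Γ ⊩ s^ m t ≐ s^ n u → ∃ λ o → Γ ⊩ t ≐ s^ (suc o) u
s^-<-cancel {Γ} {m} {t = t} {u} m<n e with s^-< u m<n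
... | o , eq = o , s^-cancel m (subst (λ x → Γ ⊩ s^ m t ≐ x) eq e)

s^-<-⊥ : ∀ {Γ m n t} → m < n → Γ ⊩ s^ n t ≐ s^ m t → Γ ⊩ ⊥'
s^-<-⊥ m<n e with s^-<-cancel m<n (≐-sym e)
... | o , t≐s^t = s^-acyclic o (≐-sym t≐s^t)

s^-≢ : ∀ {Γ m n t} → m ≢ n → Γ ⊩ s^ m t ≐ s^ n t → Γ ⊩ ⊥'
s^-≢ {m = m} {n} m≢n e with ℕ.<-cmp m n
... | tri< m<n _ _ = s^-<-⊥ m<n (≐-sym e)
... | tri≈ _ m≡n _ = ⊥-elim (m≢n m≡n)
... | tri> _ _ n<m = s^-<-⊥ n<m e

numeral-or-s^ : ∀ {Γ C a} m n w → Γ ⊩ a ≐ s^ m w →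
                (∀ k → Γ ⊩ a ≐ s^ k 0' ⇒ C) → (∀ v → Γ ⊩ a ≐ s^ (m + n) v ⇒ C) → Γ ⊩ C
numeral-or-s^ {Γ} {a = a} m zero w e numeral shifted =
  app (shifted w) (subst (λ k → Γ ⊩ a ≐ s^ k w) (sym (ℕ.+-identityʳ m)) e)
numeral-or-s^ {Γ} {C} {a} m (suc n) w e numeral shifted = by-cases (w ≐ 0')
  (app (wk (numeral m)) (≐-trans (wk e) (s^-cong m hyp)))
  (numeral-or-s^ (suc m) n (p' w) a≐s^[1+m]pw (wk ∘ numeral) (λ v → wk (shifted′ v)))
  where
  a≐s^[1+m]pw : Γ ,, ¬' (w ≐ 0') ⊩ a ≐ s^ (suc m) (p' w)
  a≐s^[1+m]pw = subst (λ x → Γ ,, ¬' (w ≐ 0') ⊩ a ≐ x) (s^-suc m (p' w))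
                      (≐-trans (wk e) (s^-cong m (≢0⇒≐s-p hyp)))
  shifted′ : ∀ v → Γ ⊩ a ≐ s^ (suc m + n) v ⇒ C
  shifted′ v = subst (λ k → Γ ⊩ a ≐ s^ k v ⇒ C) (ℕ.+-suc m n) (shifted v)

infixr 9 _·_
_·_ : ℕ → Term → Term
zero  · t = 0'
suc k · t = t +' k · t

·-+ : ∀ {Γ} m n t → Γ ⊩ (m + n) · t ≐ m · t +' n · t
·-+ zero    n t = ≐-sym (+-identityˡ _)
·-+ (suc m) n t = ≐-trans (+-congˡ t (·-+ m n t)) (≐-sym (+-assoc t (m · t) (n · t)))

·-s^ : ∀ {Γ} k m t → Γ ⊩ k · s^ m t ≐ s^ (k * m) (k · t)
·-s^ zero    m t = ≐-refl 0'
·-s^ (suc k) m t = ≐-trans (+-congˡ (s^ m t) (·-s^ k m t)) (s^-+-s^ m (k * m) t (k · t))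

+-interchange : ∀ {Γ} a b c d → Γ ⊩ (a +' b) +' (c +' d) ≐ (a +' c) +' (b +' d)
+-interchange {Γ} a b c d = begin
  (a +' b) +' (c +' d)  ≈⟨ +-assoc a b (c +' d) ⟩
  a +' (b +' (c +' d))  ≈⟨ +-congˡ a (+-assoc b c d) ⟨
  a +' ((b +' c) +' d)  ≈⟨ +-congˡ a (+-congʳ d (+-comm b c)) ⟩
  a +' ((c +' b) +' d)  ≈⟨ +-congˡ a (+-assoc c b d) ⟩
  a +' (c +' (b +' d))  ≈⟨ +-assoc a c (b +' d) ⟨
  (a +' c) +' (b +' d)  ∎
  where open ≐-Reasoning Γ

Σs^ : ℕ → Term → Term → Term
Σs^ zero    t u = u
Σs^ (suc r) t u = s^ (suc r) t +' Σs^ r t u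

▷-iterate : ∀ {Γ t u} r → Γ ⊩ t ▷ u → Γ ⊩ s^ r t ▷ Σs^ r t u
▷-iterate zero    h = h
▷-iterate (suc r) h = ▷-step (▷-iterate r h)

Σ-exponent : ℕ → ℕ → ℕ
Σ-exponent n zero    = 0
Σ-exponent n (suc r) = (suc r + n) + Σ-exponent n r

Σs^-s^ : ∀ {Γ} n w u r → Γ ⊩ Σs^ r (s^ n w) u ≐ s^ (Σ-exponent n r) (r · w +' u)
Σs^-s^ n w u zero = ≐-sym (+-identityˡ u)
Σs^-s^ {Γ} n w u (suc r) = begin
  s^ (suc r) (s^ n w) +' Σs^ r (s^ n w) u       ≡⟨ cong (_+' Σs^ r (s^ n w) u) (s^-+ (suc r) n w) ⟩
  s^ (suc r + n) w +' Σs^ r (s^ n w) u          ≈⟨ +-congˡ _ (Σs^-s^ n w u r) ⟩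
  s^ (suc r + n) w +' s^ E (r · w +' u)         ≈⟨ s^-+-s^ (suc r + n) E w (r · w +' u) ⟩
  s^ (suc r + n + E) (w +' (r · w +' u))        ≈⟨ s^-cong (suc r + n + E) (+-assoc w (r · w) u) ⟨
  s^ (suc r + n + E) ((w +' r · w) +' u)        ∎
  where
  E = Σ-exponent n r
  open ≐-Reasoning Γ

Σ-exponent-≥ : ∀ n r → r * suc n ≤ Σ-exponent n r
Σ-exponent-≥ n zero    = z≤n
Σ-exponent-≥ n (suc r) = ℕ.+-mono-≤ (s≤s (ℕ.m≤n+m n r)) (Σ-exponent-≥ n r)

-- Linear normal forms

-- Unlike A [ t ], substitution by replace₀ keeps the other free variables in place.
replace₀ : Term → Subst
replace₀ t zero    = t
replace₀ t (suc x) = var (suc x)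

_[_]₀ : Formula → Term → Formula
ψ [ t ]₀ = sub (replace₀ t) ψ

-- `linear k d n` stands for the term s^n (k·u + d) in u, where d does not contain variable 0.
record Linear : Set where
  constructor linear
  field
    coeff  : ℕ
    const  : Term
    offset : ℕ
open Linear

⟦_⟧ : Linear → Term → Term
⟦ l ⟧ u = s^ (offset l) (coeff l · u +' const l)

suc-linear : Linear → Linear
suc-linear (linear k d n) = linear k d (suc n)

-- The last clause is junk: linearize-offset rules it out whenever p-count t ≤ L.
pred-linear : Linear → Linear
pred-linear (linear k       d (suc n)) = linear k d n
pred-linear (linear zero    d zero)    = linear zero (p' d) zero
pred-linear (linear (suc k) d zero)    = linear (suc k) d zero

add-linear : Linear → Linear → Linear
add-linear (linear k d n) (linear k' d' n') = linear (k + k') (d +' d') (n + n')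

p-count : Term → ℕ
p-count (var _)  = 0
p-count 0'       = 0
p-count (s' t)   = p-count t
p-count (p' t)   = suc (p-count t)
p-count (t +' u) = p-count t + p-count u

x-count : Term → ℕ
x-count (var zero)    = 1
x-count (var (suc _)) = 0
x-count 0'            = 0
x-count (s' t)        = x-count t
x-count (p' t)        = x-count t
x-count (t +' u)      = x-count t + x-count u

linearize : ℕ → Term → Linear
linearize L (var zero)    = linear 1 0' L
linearize L (var (suc x)) = linear 0 (var (suc x)) 0
linearize L 0'            = linear 0 0' 0
linearize L (s' t)        = suc-linear (linearize L t)
linearize L (p' t)        = pred-linear (linearize L t)
linearize L (t +' u)      = add-linear (linearize L t) (linearize L u)

coeff-pred-linear : ∀ l → coeff (pred-linear l) ≡ coeff l
coeff-pred-linear (linear k       d (suc n)) = refl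
coeff-pred-linear (linear zero    d zero)    = refl
coeff-pred-linear (linear (suc k) d zero)    = refl

coeff-linearize : ∀ L t → coeff (linearize L t) ≡ x-count t
coeff-linearize L (var zero)    = refl
coeff-linearize L (var (suc x)) = refl
coeff-linearize L 0'            = refl
coeff-linearize L (s' t)        = coeff-linearize L t
coeff-linearize L (p' t)        = trans (coeff-pred-linear (linearize L t)) (coeff-linearize L t)
coeff-linearize L (t +' u)      = cong₂ _+_ (coeff-linearize L t) (coeff-linearize L u)

offset-pred-linear : ∀ {L c} l → 0 < coeff l → L ≤ offset l + c → L ≤ offset (pred-linear l) + suc c
offset-pred-linear {L} {c} (linear k d (suc n)) _ le = subst (L ≤_) (sym (ℕ.+-suc n c)) le
offset-pred-linear (linear (suc k) d zero) _ le = ℕ.m≤n⇒m≤1+n le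

-- Once variable 0 occurs, the p's of t can eat at most p-count t of the L successors.
linearize-offset : ∀ L t → 0 < x-count t → L ≤ offset (linearize L t) + p-count t
linearize-offset L (var zero) _ = ℕ.m≤m+n L 0
linearize-offset L (s' t) h = ℕ.m≤n⇒m≤1+n (linearize-offset L t h)
linearize-offset L (p' t) h =
  offset-pred-linear (linearize L t) (subst (0 <_) (sym (coeff-linearize L t)) h) (linearize-offset L t h)
linearize-offset L (t +' u) h with x-count t in eq
... | suc _ = ℕ.≤-trans (linearize-offset L t (subst (0 <_) (sym eq) (s≤s z≤n)))
                (ℕ.+-mono-≤ (ℕ.m≤m+n (offset (linearize L t)) _) (ℕ.m≤m+n (p-count t) _))
... | zero  = ℕ.≤-trans (linearize-offset L u h)
                (ℕ.+-mono-≤ (ℕ.m≤n+m (offset (linearize L u)) (offset (linearize L t)))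
                            (ℕ.m≤n+m (p-count u) (p-count t)))

pred-linear-sound : ∀ {Γ} l u → (0 < coeff l → 0 < offset l) → Γ ⊩ p' (⟦ l ⟧ u) ≐ ⟦ pred-linear l ⟧ u
pred-linear-sound (linear k d (suc n)) u _ = p-s _
pred-linear-sound (linear zero d zero) u _ = ≐-trans (p-cong (+-identityˡ d)) (≐-sym (+-identityˡ (p' d)))
pred-linear-sound (linear (suc k) d zero) u h with h (s≤s z≤n)
... | ()

add-linear-sound : ∀ {Γ} l r u → Γ ⊩ ⟦ l ⟧ u +' ⟦ r ⟧ u ≐ ⟦ add-linear l r ⟧ u
add-linear-sound {Γ} (linear k d n) (linear k' d' n') u = begin
  s^ n (k · u +' d) +' s^ n' (k' · u +' d')         ≈⟨ s^-+-s^ n n' _ _ ⟩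
  s^ (n + n') ((k · u +' d) +' (k' · u +' d'))      ≈⟨ s^-cong (n + n') (+-interchange (k · u) d (k' · u) d') ⟩
  s^ (n + n') ((k · u +' k' · u) +' (d +' d'))      ≈⟨ s^-cong (n + n') (+-congʳ (d +' d') (·-+ k k' u)) ⟨
  s^ (n + n') ((k + k') · u +' (d +' d'))           ∎
  where open ≐-Reasoning Γ

linearize-sound : ∀ {Γ} L u t → p-count t ≤ L → Γ ⊩ subT (replace₀ (s^ L u)) t ≐ ⟦ linearize L t ⟧ u
linearize-sound L u (var zero) _ =
  s^-cong L (≐-sym (≐-trans (+-identityʳ (u +' 0')) (+-identityʳ u)))
linearize-sound L u (var (suc x)) _ = ≐-sym (+-identityˡ _)
linearize-sound L u 0'            _ = ≐-sym (+-identityʳ 0')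
linearize-sound L u (s' t)        h = s-cong (linearize-sound L u t h)
linearize-sound L u (p' t)        h =
  ≐-trans (p-cong (linearize-sound L u t (ℕ.≤-trans (ℕ.n≤1+n _) h)))
          (pred-linear-sound (linearize L t) u offset-pos)
  where
  offset-pos : 0 < coeff (linearize L t) → 0 < offset (linearize L t)
  offset-pos c>0 = ℕ.+-cancelʳ-≤ (p-count t) 1 _
    (ℕ.≤-trans h (linearize-offset L t (subst (0 <_) (coeff-linearize L t) c>0)))
linearize-sound L u (t +' t') h =
  ≐-trans (+-cong (linearize-sound L u t (ℕ.≤-trans (ℕ.m≤m+n _ _) h))
                  (linearize-sound L u t' (ℕ.≤-trans (ℕ.m≤n+m _ _) h)))
          (add-linear-sound (linearize L t) (linearize L t') u)

⟦⟧-s^ : ∀ {Γ} l M u → Γ ⊩ ⟦ l ⟧ (s^ M u) ≐ s^ (coeff l * M) (⟦ l ⟧ u)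
⟦⟧-s^ {Γ} (linear k d n) M u = begin
  s^ n (k · s^ M u +' d)          ≈⟨ s^-cong n (+-congʳ d (·-s^ k M u)) ⟩
  s^ n (s^ (k * M) (k · u) +' d)  ≈⟨ s^-cong n (s^-+ˡ (k * M) (k · u) d) ⟩
  s^ n (s^ (k * M) (k · u +' d))  ≡⟨ s^-comm n (k * M) _ ⟩
  s^ (k * M) (s^ n (k · u +' d))  ∎
  where open ≐-Reasoning Γ

-- Atoms of ψ(s^L u)

data Atom : Set where
  _≐ₗ_ _▷ₗ_ : Linear → Linear → Atom

atom : Atom → Term → Formula
atom (l ≐ₗ r) u = ⟦ l ⟧ u ≐ ⟦ r ⟧ u
atom (l ▷ₗ r) u = ⟦ l ⟧ u ▷ ⟦ r ⟧ u

varying : Atom → List Atom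
varying (linear k d n ≐ₗ linear k' d' n') with k ≟ k'
... | yes _ = []
... | no  _ = (linear k d n ≐ₗ linear k' d' n') ∷ []
varying (linear zero d n ▷ₗ linear zero d' n') = []
varying α = α ∷ []

frozen : Atom → Formula
frozen (linear k d n ≐ₗ linear k' d' n') with k ≟ k'
... | yes _ = s^ n d ≐ s^ n' d'
... | no  _ = ⊥'
frozen (linear zero d n ▷ₗ linear zero d' n') = s^ n (0' +' d) ▷ s^ n' (0' +' d')
frozen α = ⊥'

atom↔frozen : ∀ {Γ} α u → Γ ⊩ avoids atom (varying α) u → Γ ⊩ atom α u ⇔ frozen α
atom↔frozen (linear k d n ≐ₗ linear k' d' n') u h with k ≟ k'
... | no  _    = ∧-elimˡ h , lam (explode hyp)
... | yes refl =
  lam (+-cancelˡ (≐-trans (s^-+ʳ n (k · u) d) (≐-trans hyp (≐-sym (s^-+ʳ n' (k · u) d'))))) ,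
  lam (≐-trans (≐-sym (s^-+ʳ n (k · u) d)) (≐-trans (+-congˡ (k · u) hyp) (s^-+ʳ n' (k · u) d')))
atom↔frozen (linear zero d n ▷ₗ linear zero d' n')       u h = lam hyp , lam hyp
atom↔frozen (linear zero d n ▷ₗ linear (suc k') d' n')   u h = ∧-elimˡ h , lam (explode hyp)
atom↔frozen (linear (suc k) d n ▷ₗ r)                    u h = ∧-elimˡ h , lam (explode hyp)

Sparse : Atom → Set
Sparse α = ∀ {Γ} u m → Γ ⊩ atom α u → Γ ⊩ atom α (s^ (suc m) u) → Γ ⊩ ⊥'

≐ₗ-sparse : ∀ l r → coeff l ≢ coeff r → Sparse (l ≐ₗ r)
≐ₗ-sparse l r k≢k' {Γ} u m e e' = s^-≢ kM≢k'M (begin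
  s^ (coeff l * M) (⟦ l ⟧ u)   ≈⟨ ⟦⟧-s^ l M u ⟨
  ⟦ l ⟧ (s^ M u)               ≈⟨ e' ⟩
  ⟦ r ⟧ (s^ M u)               ≈⟨ ⟦⟧-s^ r M u ⟩
  s^ (coeff r * M) (⟦ r ⟧ u)   ≈⟨ s^-cong (coeff r * M) e ⟨
  s^ (coeff r * M) (⟦ l ⟧ u)   ∎)
  where
  M : ℕ
  M = suc m
  kM≢k'M : coeff l * M ≢ coeff r * M
  kM≢k'M = k≢k' ∘ ℕ.*-cancelʳ-≡ (coeff l) (coeff r) M
  open ≐-Reasoning Γ

-- The left side does not move, so A9 makes ⟦r⟧u a fixed point of a positive power of s.
▷ₗ-sparseʳ : ∀ d n k' d' n' → Sparse (linear zero d n ▷ₗ linear (suc k') d' n')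
▷ₗ-sparseʳ d n k' d' n' u m h h' =
  s^-acyclic (m + k' * suc m) (≐-sym (▷-functional h (▷-respʳ-≐ (⟦⟧-s^ r (suc m) u) h')))
  where
  r : Linear
  r = linear (suc k') d' n'

-- Iterating A7 A = (k+1)M times from ⟦l⟧u ▷ R reaches ⟦l⟧(s^M u) = s^A ⟦l⟧u, whose ▷-value
-- must then be both s^(k'M) R and s^E (A·w + R) with E > k'M.
▷ₗ-sparseˡ : ∀ k d n r → coeff r ≤ n → Sparse (linear (suc k) d n ▷ₗ r)
▷ₗ-sparseˡ k d n r k'≤n {Γ} u m h h' = absurd (s^-<-cancel k'M<E s^k'M-R≐)
  where
  l : Linear
  l = linear (suc k) d n
  w R : Term
  w = suc k · u +' d
  R = ⟦ r ⟧ u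
  M A E : ℕ
  M = suc m
  A = suc k * M
  E = Σ-exponent n A

  k'M<E : coeff r * M < E
  k'M<E = begin-strict
    coeff r * M  ≤⟨ ℕ.*-monoˡ-≤ M k'≤n ⟩
    n * M        <⟨ ℕ.m<n+m (n * M) (s≤s z≤n) ⟩
    suc n * M    ≡⟨ ℕ.*-comm (suc n) M ⟩
    M * suc n    ≤⟨ ℕ.*-monoˡ-≤ (suc n) (ℕ.m≤m+n M (k * M)) ⟩
    A * suc n    ≤⟨ Σ-exponent-≥ n A ⟩
    E            ∎
    where open ℕ.≤-Reasoning

  s^k'M-R≐ : Γ ⊩ s^ (coeff r * M) R ≐ s^ E (A · w +' R)
  s^k'M-R≐ = ≐-trans (▷-functional (▷-respˡ-≐ (⟦⟧-s^ l M u) (▷-respʳ-≐ (⟦⟧-s^ r M u) h'))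
                                   (▷-iterate A h))
                     (Σs^-s^ n w R A)

  absurd : (∃ λ o → Γ ⊩ R ≐ s^ (suc o) (A · w +' R)) → Γ ⊩ ⊥'
  absurd (o , R≐) = s^-+-acyclic o (A · w) R (≐-sym R≐)

Tame : Atom → Set
Tame (l ≐ₗ r) = ⊤
Tame (l ▷ₗ r) = 0 < coeff l → coeff r ≤ offset l

varying-sparse : ∀ α → Tame α → All Sparse (varying α)
varying-sparse (linear k d n ≐ₗ linear k' d' n') _ with k ≟ k'
... | yes _   = []
... | no k≢k' = ≐ₗ-sparse (linear k d n) (linear k' d' n') k≢k' ∷ []
varying-sparse (linear zero d n ▷ₗ linear zero d' n')     _ = []
varying-sparse (linear zero d n ▷ₗ linear (suc k') d' n') _ = ▷ₗ-sparseʳ d n k' d' n' ∷ []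
varying-sparse (linear (suc k) d n ▷ₗ r) tame = ▷ₗ-sparseˡ k d n r (tame (s≤s z≤n)) ∷ []

module _ (L : ℕ) where

  varyingAtoms : ∀ {ψ} → QF ψ → List Atom
  varyingAtoms ⊥'       = []
  varyingAtoms (t ≐ u)  = varying (linearize L t ≐ₗ linearize L u)
  varyingAtoms (t ▷ u)  = varying (linearize L t ▷ₗ linearize L u)
  varyingAtoms (a ⇒ b)  = varyingAtoms a ++ varyingAtoms b
  varyingAtoms (a ∧' b) = varyingAtoms a ++ varyingAtoms b
  varyingAtoms (a ∨' b) = varyingAtoms a ++ varyingAtoms b

  frozenFormula : ∀ {ψ} → QF ψ → Formula
  frozenFormula ⊥'       = ⊥'
  frozenFormula (t ≐ u)  = frozen (linearize L t ≐ₗ linearize L u)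
  frozenFormula (t ▷ u)  = frozen (linearize L t ▷ₗ linearize L u)
  frozenFormula (a ⇒ b)  = frozenFormula a ⇒ frozenFormula b
  frozenFormula (a ∧' b) = frozenFormula a ∧' frozenFormula b
  frozenFormula (a ∨' b) = frozenFormula a ∨' frozenFormula b

threshold : ∀ {ψ} → QF ψ → ℕ
threshold ⊥'       = 0
threshold (t ≐ u)  = (p-count t + x-count u) + p-count u
threshold (t ▷ u)  = (p-count t + x-count u) + p-count u
threshold (a ⇒ b)  = threshold a + threshold b
threshold (a ∧' b) = threshold a + threshold b
threshold (a ∨' b) = threshold a + threshold b

instance↔frozen : ∀ {Γ ψ} L u (q : QF ψ) → threshold q ≤ L →
                  Γ ⊩ avoids atom (varyingAtoms L q) u → Γ ⊩ ψ [ s^ L u ]₀ ⇔ frozenFormula L q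
instance↔frozen L u ⊥' _ _ = lam hyp , lam hyp
instance↔frozen L u (t ≐ t') h av = ⇔-trans
  (≐-⇔ (linearize-sound L u t (ℕ.m+n≤o⇒m≤o _ (ℕ.m+n≤o⇒m≤o _ h)))
       (linearize-sound L u t' (ℕ.m+n≤o⇒n≤o _ h)))
  (atom↔frozen (linearize L t ≐ₗ linearize L t') u av)
instance↔frozen L u (t ▷ t') h av = ⇔-trans
  (▷-⇔ (linearize-sound L u t (ℕ.m+n≤o⇒m≤o _ (ℕ.m+n≤o⇒m≤o _ h)))
       (linearize-sound L u t' (ℕ.m+n≤o⇒n≤o _ h)))
  (atom↔frozen (linearize L t ▷ₗ linearize L t') u av)
instance↔frozen L u (a ⇒ b) h av = ⇔-⇒
  (instance↔frozen L u a (ℕ.m+n≤o⇒m≤o _ h) (proj₁ (avoids-++ atom (varyingAtoms L a) _ av)))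
  (instance↔frozen L u b (ℕ.m+n≤o⇒n≤o _ h) (proj₂ (avoids-++ atom (varyingAtoms L a) _ av)))
instance↔frozen L u (a ∧' b) h av = ⇔-∧
  (instance↔frozen L u a (ℕ.m+n≤o⇒m≤o _ h) (proj₁ (avoids-++ atom (varyingAtoms L a) _ av)))
  (instance↔frozen L u b (ℕ.m+n≤o⇒n≤o _ h) (proj₂ (avoids-++ atom (varyingAtoms L a) _ av)))
instance↔frozen L u (a ∨' b) h av = ⇔-∨
  (instance↔frozen L u a (ℕ.m+n≤o⇒m≤o _ h) (proj₁ (avoids-++ atom (varyingAtoms L a) _ av)))
  (instance↔frozen L u b (ℕ.m+n≤o⇒n≤o _ h) (proj₂ (avoids-++ atom (varyingAtoms L a) _ av)))

linearize-tame : ∀ L t u → (p-count t + x-count u) + p-count u ≤ L →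
                 Tame (linearize L t ▷ₗ linearize L u)
linearize-tame L t u h c>0 = subst (_≤ offset (linearize L t)) (sym (coeff-linearize L u))
  (ℕ.+-cancelˡ-≤ (p-count t) _ _ (begin
    p-count t + x-count u               ≤⟨ ℕ.m+n≤o⇒m≤o _ h ⟩
    L                                   ≤⟨ linearize-offset L t (subst (0 <_) (coeff-linearize L t) c>0) ⟩
    offset (linearize L t) + p-count t  ≡⟨ ℕ.+-comm (offset (linearize L t)) (p-count t) ⟩
    p-count t + offset (linearize L t)  ∎))
  where open ℕ.≤-Reasoning

varyingAtoms-sparse : ∀ {ψ} L (q : QF ψ) → threshold q ≤ L → All Sparse (varyingAtoms L q)
varyingAtoms-sparse L ⊥'       _ = []
varyingAtoms-sparse L (t ≐ u)  _ = varying-sparse (linearize L t ≐ₗ linearize L u) _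
varyingAtoms-sparse L (t ▷ u)  h =
  varying-sparse (linearize L t ▷ₗ linearize L u) (linearize-tame L t u h)
varyingAtoms-sparse L (a ⇒ b)  h =
  ++⁺ (varyingAtoms-sparse L a (ℕ.m+n≤o⇒m≤o _ h)) (varyingAtoms-sparse L b (ℕ.m+n≤o⇒n≤o _ h))
varyingAtoms-sparse L (a ∧' b) h =
  ++⁺ (varyingAtoms-sparse L a (ℕ.m+n≤o⇒m≤o _ h)) (varyingAtoms-sparse L b (ℕ.m+n≤o⇒n≤o _ h))
varyingAtoms-sparse L (a ∨' b) h =
  ++⁺ (varyingAtoms-sparse L a (ℕ.m+n≤o⇒m≤o _ h)) (varyingAtoms-sparse L b (ℕ.m+n≤o⇒n≤o _ h))

-- Open induction in T▷I

sparse-s^ : ∀ {Γ α m n} w → Sparse α → m < n →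
            Γ ⊩ atom α (s^ m w) → Γ ⊩ atom α (s^ n w) → Γ ⊩ ⊥'
sparse-s^ {Γ} {α} {m} w sparse m<n h h' with s^-< w m<n
... | o , eq = sparse (s^ m w) o h (subst (λ x → Γ ⊩ atom α x) (trans eq (s^-comm m (suc o) w)) h')

sparse⇒atMostOnce : ∀ {N α} w → Sparse α → AtMostOnceOn atom (λ (i : Fin N) → s^ (toℕ i) w) α
sparse⇒atMostOnce w sparse {i = i} {j} i≢j h h' with ℕ.<-cmp (toℕ i) (toℕ j)
... | tri< i<j _ _ = sparse-s^ w sparse i<j h h'
... | tri≈ _ i≡j _ = ⊥-elim (i≢j (toℕ-injective i≡j))
... | tri> _ _ j<i = sparse-s^ w sparse j<i h' h

module OpenInduction {ψ} (q : QF ψ) where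

  L W : ℕ
  L = threshold q
  W = length (varyingAtoms L q)

  varying-once : ∀ w → All (AtMostOnceOn atom (λ (i : Fin (suc W)) → s^ (toℕ i) w)) (varyingAtoms L q)
  varying-once w = All.map (sparse⇒atMostOnce w) (varyingAtoms-sparse L q ℕ.≤-refl)

  ≐-subst₀ : ∀ {Γ t u} → Γ ⊩ t ≐ u → Γ ⊩ ψ [ t ]₀ → Γ ⊩ ψ [ u ]₀
  ≐-subst₀ = ≐-transport (sub (lift (λ x → var (suc x))) ψ)
                         (λ _ → sub-sub q (λ { zero → refl ; (suc _) → refl }))

  module _ {Γ} (base : Γ ⊩ ψ [ 0' ]₀) (step : ∀ t → Γ ⊩ ψ [ t ]₀ ⇒ ψ [ s' t ]₀) where

    iterate : ∀ r t → Γ ⊩ ψ [ t ]₀ ⇒ ψ [ s^ r t ]₀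
    iterate zero    t = lam hyp
    iterate (suc r) t = ⇒-trans (iterate r t) (step (s^ r t))

    iterate-≤ : ∀ {m n} w → m ≤ n → Γ ⊩ ψ [ s^ m w ]₀ ⇒ ψ [ s^ n w ]₀
    iterate-≤ {m} w m≤n with ℕ.m≤n⇒∃[o]m+o≡n m≤n
    ... | o , refl = subst (λ x → Γ ⊩ ψ [ s^ m w ]₀ ⇒ ψ [ x ]₀)
                           (trans (s^-+ o m w) (cong (λ k → s^ k w) (ℕ.+-comm o m)))
                           (iterate o (s^ m w))

    numeral : ∀ k → Γ ⊩ ψ [ s^ k 0' ]₀
    numeral k = app (iterate k 0') base

    frozen-holds : Γ ⊩ frozenFormula L q
    frozen-holds = pigeonhole atom (varyingAtoms L q) (λ i → s^ (toℕ i) 0') (varying-once 0') ℕ.≤-refl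
      (λ i → lam (app (proj₁ (instance↔frozen L (s^ (toℕ i) 0') q ℕ.≤-refl hyp)) (wk (ψ-at i))))
      where
      ψ-at : ∀ (i : Fin (suc W)) → Γ ⊩ ψ [ s^ L (s^ (toℕ i) 0') ]₀
      ψ-at i = subst (λ x → Γ ⊩ ψ [ x ]₀) (sym (s^-+ L (toℕ i) 0')) (numeral (L + toℕ i))

    s^-holds : ∀ w → Γ ⊩ ψ [ s^ (L + W) w ]₀
    s^-holds w = pigeonhole atom (varyingAtoms L q) (λ i → s^ (toℕ i) w) (varying-once w) ℕ.≤-refl
      (λ i → ⇒-trans (frozen⇒ψ i) (iterate-≤ w (ℕ.+-monoʳ-≤ L (toℕ≤pred[n] i))))
      where
      avoids-at : Fin (suc W) → Formula
      avoids-at i = avoids atom (varyingAtoms L q) (s^ (toℕ i) w)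
      frozen⇒ψ : ∀ i → Γ ⊩ avoids-at i ⇒ ψ [ s^ (L + toℕ i) w ]₀
      frozen⇒ψ i = subst (λ x → Γ ⊩ avoids-at i ⇒ ψ [ x ]₀) (s^-+ L (toℕ i) w)
        (lam (app (proj₂ (instance↔frozen L (s^ (toℕ i) w) q ℕ.≤-refl hyp)) (wk frozen-holds)))

    open-induction : ∀ a → Γ ⊩ ψ [ a ]₀
    open-induction a = numeral-or-s^ 0 (L + W) a (≐-refl a)
      (λ k → lam (≐-subst₀ (≐-sym hyp) (wk (numeral k))))
      (λ v → lam (≐-subst₀ (≐-sym hyp) (wk (s^-holds v))))

  Ind-provable : T▷I ⊢ Ind ψ
  Ind-provable = unwrap (lam (lam (app (wk (wk conclusion)) (∧-intro (wk hyp) hyp))))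
    where
    Base Step : Formula
    Base = ψ [ 0' ]
    Step = ∀' (ψ ⇒ sub succ-sub ψ)

    premises : Ctx
    premises = ε ,, shift Base ,, shift Step

    ψ-holds : premises ⊩ ψ
    ψ-holds = subst (premises ⊩_) (sub-id q (λ { zero → refl ; (suc _) → refl }))
                    (open-induction base step (var 0))
      where
      base : premises ⊩ ψ [ 0' ]₀
      base = subst (premises ⊩_) (sub-sub q (λ { zero → refl ; (suc _) → refl })) (wk hyp)
      step : ∀ t → premises ⊩ ψ [ t ]₀ ⇒ ψ [ s' t ]₀
      step t = subst (premises ⊩_)
        (cong₂ _⇒_ (sub-sub q (λ { zero → refl ; (suc _) → refl }))
                   (trans (sub-sub {ρ = replace₀ t} (sub-QF succ-sub q)
                                   (λ { zero → refl ; (suc _) → refl }))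
                          (sub-sub q (λ { zero → refl ; (suc _) → refl }))))
        (∀-elim hyp t)

    -- The premises are bundled into one conjunction so that ∀dist can move ∀ past them.
    premises⇒ψ : ε ⊩ shift (Base ∧' Step) ⇒ ψ
    premises⇒ψ = lam (app (app (wk (lam (lam ψ-holds))) (∧-elimˡ hyp)) (∧-elimʳ hyp))

    conclusion : ε ⊩ Base ∧' Step ⇒ ∀' ψ
    conclusion = ⟨ mp ∀dist (gen (unwrap premises⇒ψ)) ⟩

theorem3p11 : (φ : Formula) → ((T▷ ∪ IOpen) ⊢ φ → T▷I ⊢ φ) × (T▷I ⊢ φ → (T▷ ∪ IOpen) ⊢ φ)
theorem3p11 φ = ⊢-cut IOpen-in-T▷I , ⊢-cut B-in-IOpen
  where
  IOpen-in-T▷I : ∀ {A} → (T▷ ∪ IOpen) A → T▷I ⊢ A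
  IOpen-in-T▷I (inj₁ a)       = ax (inj₁ a)
  IOpen-in-T▷I (inj₂ (ind q)) = OpenInduction.Ind-provable q
  B-in-IOpen : ∀ {A} → T▷I A → (T▷ ∪ IOpen) ⊢ A
  B-in-IOpen (inj₁ a) = ax (inj₁ a)
  B-in-IOpen (inj₂ b) = B-axioms-from-IOpen.B-axiom-provable b
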